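{- Let $\Gamma$ be a locally semicomplete commutative weakly distance-regular digraph with $4\in T$. If $(1,3)$ is mixed, then $p_{(1,2),(2,1)}^{(1,3)}=0$ and the configuration C$(4)$ exists.
   Context: Digraphs are finite with arcs being ordered pairs of distinct vertices; $N^\pm(x)$ out-/in-neighbourhoods; circuits of length $r$ are paths $(w_0,\dots,w_{r-1})$ with $(w_{r-1},w_0)$ an arc; $\partial$ distance, $\tilde\partial(x,y)=(\partial(x,y),\partial(y,x))$, $\tilde\partial(\Gamma)$ its value set. Weakly distance-regular: strongly connected and the number $p^{\tilde h}_{\tilde i,\tilde j}$ of $z$ with $\tilde\partial(x,z)=\tilde i$, $\tilde\partial(z,y)=\tilde j$ depends only on $\tilde h=\tilde\partial(x,y)$ (taken to be $0$ if no such $z$ exist); commutative: $p^{\tilde h}_{\tilde i,\tilde j}=p^{\tilde h}_{\tilde j,\tilde i}$. Locally semicomplete: each $N^+(x)$, $N^-(x)$ induces a digraph in which any two distinct vertices are joined by at least one arc. An arc $(x,y)$ has type $(1,r)$ if $\partial(y,x)=r$; $T=\{q:(1,q-1)\in\tilde\partial(\Gamma)\}$. For $q\in T$, $(1,q-1)$ is pure if every circuit of length $q$ containing an arc of type $(1,q-1)$ consists of arcs of type $(1,q-1)$, and mixed otherwise. C$(q)$ exists if $p^{(1,q-2)}_{(1,q-1),(1,q-1)}\neq0$ and $(1,q-2)$ is pure. -}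

module Defs where

open import Data.Bool using (Bool; true; false; _∧_; if_then_else_)
open import Data.Nat using (ℕ; zero; suc; _∸_; _<?_)
open import Data.Nat.Properties using () renaming (_≟_ to _≟ℕ_)
open import Data.Fin using (Fin; toℕ; fromℕ<) renaming (_≟_ to _≟F_)
open import Data.Fin.Base using () renaming (zero to fzero)
open import Data.List using (List; []; _∷_; allFin; upTo; filter; length; concatMap; map)
open import Data.Bool.ListAction using (any)
open import Data.Product using (Σ; ∃; _×_; _,_; proj₁; proj₂)
open import Data.Product.Properties using (≡-dec)
open import Data.Sum using (_⊎_)
open import Data.Unit using (⊤)
open import Relation.Nullary using (¬_; does; yes; no)
open import Relation.Binary.PropositionalEquality using (_≡_; _≢_)
open import Function using (_∘_)
open import Function.Definitions using (Injective)

record Digraph : Set where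
  field
    n        : ℕ
    arc      : Fin n → Fin n → Bool
    loopless : ∀ x → arc x x ≡ false

module _ (Γ : Digraph) where
  open Digraph Γ

  V : Set
  V = Fin n

  Arc : V → V → Set
  Arc x y = arc x y ≡ true

  reach : ℕ → V → V → Bool
  reach zero    x y = does (x ≟F y)
  reach (suc k) x y = any (λ z → arc x z ∧ reach k z y) (allFin n)

  firstReach : List ℕ → V → V → ℕ
  firstReach []       x y = n
  firstReach (k ∷ ks) x y = if reach k x y then k else firstReach ks x y

  -- distance ∂(x,y): length of a shortest walk (= shortest path) from x to y;
  -- shortest paths have length < n, so searching 0..n-1 suffices
  -- (value n is a default for unreachable pairs, irrelevant when strongly connected)
  ∂ : V → V → ℕ
  ∂ x y = firstReach (upTo n) x y

  ∂̃ : V → V → ℕ × ℕ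
  ∂̃ x y = (∂ x y , ∂ y x)

  StronglyConnected : Set
  StronglyConnected = ∀ x y → Σ ℕ λ k → reach k x y ≡ true

  InDistSet : ℕ × ℕ → Set
  InDistSet h = Σ V λ x → Σ V λ y → ∂̃ x y ≡ h

  _≟²_ : (a b : ℕ × ℕ) → _
  _≟²_ = ≡-dec _≟ℕ_ _≟ℕ_

  count : V → V → ℕ × ℕ → ℕ × ℕ → ℕ
  count x y i j =
    length (filter (λ z → ∂̃ x z ≟² i) (filter (λ z → ∂̃ z y ≟² j) (allFin n)))

  WeaklyDistanceRegular : Set
  WeaklyDistanceRegular =
    StronglyConnected ×
    (∀ x y x′ y′ → ∂̃ x y ≡ ∂̃ x′ y′ → ∀ i j → count x y i j ≡ count x′ y′ i j)

  pairs : List (V × V)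
  pairs = concatMap (λ x → map (λ y → (x , y)) (allFin n)) (allFin n)

  countAtFirst : List (V × V) → ℕ × ℕ → ℕ × ℕ → ℕ
  countAtFirst []             i j = 0
  countAtFirst ((x , y) ∷ _)  i j = count x y i j

  -- intersection number p^h_{i,j}: count at some (x,y) with ∂̃(x,y) = h,
  -- and 0 if no such pair exists
  p : ℕ × ℕ → ℕ × ℕ → ℕ × ℕ → ℕ
  p h i j = countAtFirst (filter (λ xy → ∂̃ (proj₁ xy) (proj₂ xy) ≟² h) pairs) i j

  Commutative : Set
  Commutative = ∀ h i j → p h i j ≡ p h j i

  LocallySemicomplete : Set
  LocallySemicomplete =
    (∀ x y z → Arc x y → Arc x z → y ≢ z → Arc y z ⊎ Arc z y) ×
    (∀ x y z → Arc y x → Arc z x → y ≢ z → Arc y z ⊎ Arc z y)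

  InT : ℕ → Set
  InT q = InDistSet (1 , q ∸ 1)

  next : ∀ {m} → Fin (suc m) → Fin (suc m)
  next {m} i with suc (toℕ i) <? suc m
  ... | yes lt = fromℕ< lt
  ... | no  _  = fzero

  record Circuit (m : ℕ) : Set where
    field
      w     : Fin (suc m) → V
      inj   : Injective _≡_ _≡_ w
      arcs  : ∀ i → Arc (w i) (w (next i))

  ArcHasType : ∀ {m} → Circuit m → Fin (suc m) → ℕ → Set
  ArcHasType {m} c i r = ∂̃ (Circuit.w c i) (Circuit.w c (next i)) ≡ (1 , r)

  -- (1, q-1) is pure: every circuit of length q containing an arc of type
  -- (1, q-1) consists of arcs of type (1, q-1)
  Pure : ℕ → Set
  Pure zero    = ⊤
  Pure (suc m) = (c : Circuit m) → (Σ (Fin (suc m)) λ i → ArcHasType c i m) →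
                 ∀ i → ArcHasType c i m

  Mixed : ℕ → Set
  Mixed q = InT q × ¬ Pure q

  CExists : ℕ → Set
  CExists q = (p (1 , q ∸ 2) (1 , q ∸ 1) (1 , q ∸ 1) ≢ 0) × Pure (q ∸ 1)

-- Both parts rest on one finiteness principle: if a configuration can always be
-- reproduced one step further, and local semicompleteness together with the
-- absence of short return walks along (1,3)-arcs forces every new vertex to be
-- joined in a fixed direction to all earlier ones, the digraph would contain
-- infinitely many distinct vertices.  Run inside N⁻(z), this excludes a triangle
-- x → y → z with types (1,3), (1,2) and a (1,2)-arc x → z, which is
-- p^(1,3)_(1,2),(2,1) = 0.  For C(4): if p^(1,2)_(1,3),(1,3) were 0, the arc
-- following a (1,3)-arc on a 4-circuit would again have type (1,3), so (1,3)
-- would be pure.  (Its reverse distance is 1, 2 or 3; distance 1 yields a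
-- "ladder", excluded by the same principle, and distance 2 yields a (1,3),(1,3)
-- witness for a (1,2)-arc.)  Once every (1,2)-arc has such a witness, no
-- triangle carries a (1,1)-arc followed by a (1,2)-arc, so (1,2) is pure.
module Submission where

open import Defs
open import Data.Bool using (true; false)
open import Data.Bool.Properties using (T-≡; T-∧)
open import Data.Empty using (⊥; ⊥-elim)
open import Data.Fin using (Fin; toℕ) renaming (_≟_ to _≟F_)
open import Data.Fin.Patterns using (0F; 1F; 2F; 3F)
open import Data.Fin.Properties using (pigeonhole)
open import Data.List using (List; []; _∷_; allFin; upTo; applyUpTo; length; map)
open import Data.List.Membership.Propositional using (_∈_; lose)
open import Data.List.Membership.Propositional.Properties
  using (∈-filter⁺; ∈-filter⁻; ∈-allFin; ∈-map⁺; ∈-concat⁺′; ∈-upTo⁻; ∈-length)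
open import Data.List.Relation.Unary.All using (All; []; _∷_)
open import Data.List.Relation.Unary.All.Properties using (all-filter)
open import Data.List.Relation.Unary.Any using (here; there; satisfied)
open import Data.List.Relation.Unary.Any.Properties using (any⁺; any⁻)
open import Data.Nat using (ℕ; zero; suc; _+_; _≤_; _<_; _<?_; z≤n; s≤s) renaming (_≟_ to _≟ℕ_)
open import Data.Nat.GeneralisedArithmetic using (iterate)
open import Data.Nat.Properties
  using (≤-refl; ≤-trans; ≤-reflexive; ≤-antisym; <⇒≤; <⇒≢; ≮⇒≥; n<1+n; +-suc; n≢0⇒n>0; n>0⇒n≢0; m≤n⇒∃[o]m+o≡n)
open import Data.Product using (Σ; ∃; ∃₂; _×_; _,_; proj₁; proj₂; swap)
open import Data.Sum using (_⊎_; inj₁; inj₂; [_,_]′)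
import Data.Sum as Sum
open import Function using (_∘_; id; Equivalence)
open import Relation.Nullary using (¬_; yes; no; contradiction)
open import Relation.Unary using (Decidable)
open import Relation.Nullary.Decidable using (dec-true; decidable-stable)
open import Relation.Binary.PropositionalEquality
  using (_≡_; _≢_; refl; sym; trans; cong; cong₂; subst; module ≡-Reasoning)

iterate-+ : ∀ {A : Set} (f : A → A) (x : A) m n →
            iterate f x (m + n) ≡ iterate f (iterate f x m) n
iterate-+ f x zero    n = refl
iterate-+ f x (suc m) n = iterate-+ f (f x) m n

iterate-revisits : ∀ {A : Set} {m} (f : A → A) (obs : A → Fin m) (x : A) →
                   ∃₂ λ y k → obs (iterate f y (suc k)) ≡ obs y
iterate-revisits {m = m} f obs x =
  let i , j , i<j , obsᵢ≡obsⱼ = pigeonhole (n<1+n m) (obs ∘ iterate f x ∘ toℕ)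
      k , 1+i+k≡j = m≤n⇒∃[o]m+o≡n i<j
  in iterate f x (toℕ i) , k , (begin
       obs (iterate f (iterate f x (toℕ i)) (suc k)) ≡⟨ cong obs (iterate-+ f x (toℕ i) (suc k)) ⟨
       obs (iterate f x (toℕ i + suc k))
         ≡⟨ cong (obs ∘ iterate f x) (trans (+-suc (toℕ i) k) 1+i+k≡j) ⟩
       obs (iterate f x (toℕ j))                      ≡⟨ obsᵢ≡obsⱼ ⟨
       obs (iterate f x (toℕ i))                      ∎)
  where open ≡-Reasoning

nonempty⇒∈ : ∀ {A : Set} {xs : List A} → 0 < length xs → ∃ (_∈ xs)
nonempty⇒∈ {xs = x ∷ _} _ = x , here refl

module Walks (Γ : Digraph) where
  open Digraph Γ using (n; loopless)

  private variable
    k : ℕ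
    x y : V Γ

  infix 4 _⟶_
  _⟶_ : V Γ → V Γ → Set
  _⟶_ = Arc Γ

  ⟶-irrefl : x ⟶ y → x ≢ y
  ⟶-irrefl {x} x⟶x refl = contradiction (trans (sym x⟶x) (loopless x)) λ ()

  infixr 5 _∷_
  data Walk : ℕ → V Γ → V Γ → Set where
    []  : Walk 0 x x
    _∷_ : ∀ {z} → x ⟶ y → Walk k y z → Walk (suc k) x z

  Walk-0 : Walk 0 x y → x ≡ y
  Walk-0 [] = refl

  reach⇒Walk : ∀ k → reach Γ k x y ≡ true → Walk k x y
  reach⇒Walk {x} {y} zero r with x ≟F y
  ... | yes refl = []
  ... | no  _    = contradiction r λ ()
  reach⇒Walk (suc k) r =
    let z , x⟶z∧z⇝y = satisfied (any⁻ _ (allFin n) (Equivalence.from T-≡ r))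
        x⟶z , z⇝y = Equivalence.to T-∧ x⟶z∧z⇝y
    in Equivalence.to T-≡ x⟶z ∷ reach⇒Walk k (Equivalence.to T-≡ z⇝y)

  Walk⇒reach : Walk k x y → reach Γ k x y ≡ true
  Walk⇒reach {x = x} [] = dec-true (x ≟F x) refl
  Walk⇒reach (_∷_ {y = y} x⟶y w) =
    Equivalence.to T-≡ (any⁺ _ (lose (∈-allFin y)
      (Equivalence.from T-∧ (Equivalence.from T-≡ x⟶y , Equivalence.from T-≡ (Walk⇒reach w)))))

  firstReach-found : ∀ ks x y →
    firstReach Γ ks x y ≡ n ⊎ (firstReach Γ ks x y ∈ ks × reach Γ (firstReach Γ ks x y) x y ≡ true)
  firstReach-found []       x y = inj₁ refl
  firstReach-found (k ∷ ks) x y with reach Γ k x y in r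
  ... | true  = inj₂ (here refl , r)
  ... | false = Sum.map₂ (λ (k∈ , r′) → there k∈ , r′) (firstReach-found ks x y)

  firstReach-least : ∀ (f : ℕ → ℕ) → (∀ {i j} → i ≤ j → f i ≤ f j) → ∀ {len j} →
    j < len → reach Γ (f j) x y ≡ true → firstReach Γ (applyUpTo f len) x y ≤ f j
  firstReach-least {x} {y} f mono {suc len} {j} j<len r with reach Γ (f 0) x y in r₀
  ... | true = mono z≤n
  firstReach-least f mono {suc len} {zero}  _           r | false =
    contradiction (trans (sym r) r₀) λ ()
  firstReach-least f mono {suc len} {suc j} (s≤s j<len) r | false =
    firstReach-least (f ∘ suc) (mono ∘ s≤s) j<len r

  ∂≤n : ∂ Γ x y ≤ n
  ∂≤n {x} {y} = [ ≤-reflexive , <⇒≤ ∘ ∈-upTo⁻ ∘ proj₁ ]′ (firstReach-found (upTo n) x y)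

  ∂-least : Walk k x y → ∂ Γ x y ≤ k
  ∂-least {k} w with k <? n
  ... | yes k<n = firstReach-least id id k<n (Walk⇒reach w)
  ... | no  k≮n = ≤-trans ∂≤n (≮⇒≥ k≮n)

  ∂-attained : ∂ Γ x y ≡ k → k < n → Walk k x y
  ∂-attained {x} {y} refl k<n =
    [ (λ ∂≡n → contradiction ∂≡n (<⇒≢ k<n)) , reach⇒Walk _ ∘ proj₂ ]′ (firstReach-found (upTo n) x y)

-- 3 ≤ n ensures that a value ∂ x y ≤ 2 is a genuine distance and not the
-- default n that ∂ returns on unreachable pairs.
module ArcTypes (Γ : Digraph) (3≤n : 3 ≤ Digraph.n Γ) where
  open Walks Γ

  private variable
    k r : ℕ
    x y z w : V Γ

  private
    attained : ∂ Γ x y ≡ k → k ≤ 2 → Walk k x y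
    attained ∂≡k k≤2 = ∂-attained ∂≡k (≤-trans (s≤s k≤2) 3≤n)

  ∂-pos : x ≢ y → 0 < ∂ Γ x y
  ∂-pos x≢y = n≢0⇒n>0 λ ∂≡0 → x≢y (Walk-0 (attained ∂≡0 z≤n))

  ⟶⇒∂≡1 : x ⟶ y → ∂ Γ x y ≡ 1
  ⟶⇒∂≡1 x⟶y = ≤-antisym (∂-least (x⟶y ∷ [])) (∂-pos (⟶-irrefl x⟶y))

  ∂≡1⇒⟶ : ∂ Γ x y ≡ 1 → x ⟶ y
  ∂≡1⇒⟶ ∂≡1 with attained ∂≡1 (s≤s z≤n)
  ... | x⟶y ∷ [] = x⟶y

  ∂≡2⇒path : ∂ Γ x y ≡ 2 → ∃ λ z → x ⟶ z × z ⟶ y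
  ∂≡2⇒path ∂≡2 with attained ∂≡2 ≤-refl
  ... | x⟶z ∷ z⟶y ∷ [] = _ , x⟶z , z⟶y

  infix 4 _─[_]→_
  _─[_]→_ : V Γ → ℕ → V Γ → Set
  x ─[ r ]→ y = ∂̃ Γ x y ≡ (1 , r)

  ─[]→⇒⟶ : x ─[ r ]→ y → x ⟶ y
  ─[]→⇒⟶ = ∂≡1⇒⟶ ∘ cong proj₁

  ─[]→-back : x ─[ r ]→ y → ∂ Γ y x ≡ r
  ─[]→-back = cong proj₂

  ⟶-type : (x⟶y : x ⟶ y) → x ─[ ∂ Γ y x ]→ y
  ⟶-type {x} {y} x⟶y = cong (_, ∂ Γ y x) (⟶⇒∂≡1 x⟶y)

  ─[1]→⇒⟵ : x ─[ 1 ]→ y → y ⟶ x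
  ─[1]→⇒⟵ = ∂≡1⇒⟶ ∘ ─[]→-back

  ⟷⇒─[1]→ : x ⟶ y → y ⟶ x → x ─[ 1 ]→ y
  ⟷⇒─[1]→ x⟶y y⟶x = cong₂ _,_ (⟶⇒∂≡1 x⟶y) (⟶⇒∂≡1 y⟶x)

  ─[]→-back-walk : x ─[ r ]→ y → Walk k y x → r ≤ k
  ─[]→-back-walk x─y w = subst (_≤ _) (─[]→-back x─y) (∂-least w)

  ─[3]→-¬back-arc : x ─[ 3 ]→ y → ¬ y ⟶ x
  ─[3]→-¬back-arc x─y y⟶x with ─[]→-back-walk x─y (y⟶x ∷ [])
  ... | s≤s ()

  ─[3]→-¬back-path : x ─[ 3 ]→ y → y ⟶ z → ¬ z ⟶ x
  ─[3]→-¬back-path x─y y⟶z z⟶x with ─[]→-back-walk x─y (y⟶z ∷ z⟶x ∷ [])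
  ... | s≤s (s≤s ())

  ⟶-back-distance : x ⟶ y → Walk k y x → ∃ λ r → 1 ≤ r × r ≤ k × x ─[ r ]→ y
  ⟶-back-distance x⟶y w = _ , ∂-pos (⟶-irrefl x⟶y ∘ sym) , ∂-least w , ⟶-type x⟶y

  triangle-type : x ⟶ y → y ⟶ z → z ⟶ x → y ⟶ x ⊎ x ─[ 2 ]→ y
  triangle-type x⟶y y⟶z z⟶x with ⟶-back-distance x⟶y (y⟶z ∷ z⟶x ∷ [])
  ... | 1 , _ , _ , x─y = inj₁ (─[1]→⇒⟵ x─y)
  ... | 2 , _ , _ , x─y = inj₂ x─y
  ... | suc (suc (suc _)) , _ , s≤s (s≤s ()) , _

  triangle-─[2]→ : x ⟶ y → y ⟶ z → z ⟶ x → ¬ y ⟶ x → x ─[ 2 ]→ y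
  triangle-─[2]→ x⟶y y⟶z z⟶x ¬y⟶x = [ ⊥-elim ∘ ¬y⟶x , id ]′ (triangle-type x⟶y y⟶z z⟶x)

  square-type : x ⟶ y → y ⟶ z → z ⟶ w → w ⟶ x → y ⟶ x ⊎ x ─[ 2 ]→ y ⊎ x ─[ 3 ]→ y
  square-type x⟶y y⟶z z⟶w w⟶x with ⟶-back-distance x⟶y (y⟶z ∷ z⟶w ∷ w⟶x ∷ [])
  ... | 1 , _ , _ , x─y = inj₁ (─[1]→⇒⟵ x─y)
  ... | 2 , _ , _ , x─y = inj₂ (inj₁ x─y)
  ... | 3 , _ , _ , x─y = inj₂ (inj₂ x─y)
  ... | suc (suc (suc (suc _))) , _ , s≤s (s≤s (s≤s ())) , _

module IntersectionNumbers (Γ : Digraph) (wdr : WeaklyDistanceRegular Γ) where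
  open Digraph Γ using (n)

  private variable
    h i j : ℕ × ℕ
    x y x′ y′ : V Γ

  Witness : V Γ → V Γ → ℕ × ℕ → ℕ × ℕ → Set
  Witness x y i j = ∃ λ z → ∂̃ Γ x z ≡ i × ∂̃ Γ z y ≡ j

  Witness⇒count≢0 : Witness x y i j → count Γ x y i j ≢ 0
  Witness⇒count≢0 {x} {y} {i} {j} (z , x~z , z~y) =
    n>0⇒n≢0 (∈-length (∈-filter⁺ (λ z → _≟²_ Γ (∂̃ Γ x z) i)
                         (∈-filter⁺ (λ z → _≟²_ Γ (∂̃ Γ z y) j) (∈-allFin z) z~y) x~z))

  count≢0⇒Witness : count Γ x y i j ≢ 0 → Witness x y i j
  count≢0⇒Witness {x} {y} {i} {j} count≢0 =
    let z , z∈ = nonempty⇒∈ (n≢0⇒n>0 count≢0)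
        z∈′ , x~z = ∈-filter⁻ (λ z → _≟²_ Γ (∂̃ Γ x z) i) z∈
        _ , z~y = ∈-filter⁻ (λ z → _≟²_ Γ (∂̃ Γ z y) j) {xs = allFin n} z∈′
    in z , x~z , z~y

  OfType : ℕ × ℕ → V Γ × V Γ → Set
  OfType h (x , y) = ∂̃ Γ x y ≡ h

  pairs-complete : ∀ x y → (x , y) ∈ pairs Γ
  pairs-complete x y =
    ∈-concat⁺′ (∈-map⁺ (x ,_) (∈-allFin y)) (∈-map⁺ (λ x → map (x ,_) (allFin n)) (∈-allFin x))

  of-type? : ∀ h → Decidable (OfType h)
  of-type? h (x , y) = _≟²_ Γ (∂̃ Γ x y) h

  p≡count : ∂̃ Γ x y ≡ h → p Γ h i j ≡ count Γ x y i j
  p≡count {x} {y} {h} {i} {j} x~y = atFirst (all-filter (of-type? h) (pairs Γ))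
    (∈-filter⁺ (of-type? h) (pairs-complete x y) x~y)
    where
    atFirst : ∀ {l} → All (OfType h) l → (x , y) ∈ l → countAtFirst Γ l i j ≡ count Γ x y i j
    atFirst {(a , b) ∷ _} (a~b ∷ _) _ = proj₂ wdr a b x y (trans a~b (sym x~y)) i j

  p≡0 : (∀ {x y} → ∂̃ Γ x y ≡ h → ¬ Witness x y i j) → p Γ h i j ≡ 0
  p≡0 {h} {i} {j} ¬witness = atFirst (all-filter (of-type? h) (pairs Γ))
    where
    atFirst : ∀ {l} → All (OfType h) l → countAtFirst Γ l i j ≡ 0
    atFirst []        = refl
    atFirst (a~b ∷ _) = decidable-stable (_ ≟ℕ 0) (¬witness a~b ∘ count≢0⇒Witness)

  Witness⇒p≢0 : ∂̃ Γ x y ≡ h → Witness x y i j → p Γ h i j ≢ 0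
  Witness⇒p≢0 x~y w = Witness⇒count≢0 w ∘ trans (sym (p≡count x~y))

  p≢0⇒Witness : ∂̃ Γ x y ≡ h → p Γ h i j ≢ 0 → Witness x y i j
  p≢0⇒Witness x~y p≢0 = count≢0⇒Witness (p≢0 ∘ trans (p≡count x~y))

  Witness-invariant : ∂̃ Γ x y ≡ ∂̃ Γ x′ y′ → Witness x y i j → Witness x′ y′ i j
  Witness-invariant {x} {y} {x′} {y′} {i} {j} x~y≡x′~y′ w =
    count≢0⇒Witness (Witness⇒count≢0 w ∘ trans (proj₂ wdr x y x′ y′ x~y≡x′~y′ i j))

  Witness-comm : Commutative Γ → Witness x y i j → Witness x y j i
  Witness-comm {x} {y} {i} {j} comm w = count≢0⇒Witness (Witness⇒count≢0 w ∘ trans count-comm)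
    where
    open ≡-Reasoning
    count-comm : count Γ x y i j ≡ count Γ x y j i
    count-comm = begin
      count Γ x y i j    ≡⟨ p≡count refl ⟨
      p Γ (∂̃ Γ x y) i j  ≡⟨ comm _ i j ⟩
      p Γ (∂̃ Γ x y) j i  ≡⟨ p≡count refl ⟩
      count Γ x y j i    ∎

module Circuits (Γ : Digraph) where
  open Walks Γ

  around₃ : {P : Fin 3 → Set} → (∀ i → P i → P (next Γ i)) → ∀ i → P i → ∀ j → P j
  around₃ {P} step i Pᵢ j = from-0F j (to-0F i Pᵢ)
    where
    to-0F : ∀ i → P i → P 0F
    to-0F 0F = id
    to-0F 1F = step 2F ∘ step 1F
    to-0F 2F = step 2F
    from-0F : ∀ j → P 0F → P j
    from-0F 0F = id
    from-0F 1F = step 0F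
    from-0F 2F = step 1F ∘ step 0F

  around₄ : {P : Fin 4 → Set} → (∀ i → P i → P (next Γ i)) → ∀ i → P i → ∀ j → P j
  around₄ {P} step i Pᵢ j = from-0F j (to-0F i Pᵢ)
    where
    to-0F : ∀ i → P i → P 0F
    to-0F 0F = id
    to-0F 1F = step 3F ∘ step 2F ∘ step 1F
    to-0F 2F = step 3F ∘ step 2F
    to-0F 3F = step 3F
    from-0F : ∀ j → P 0F → P j
    from-0F 0F = id
    from-0F 1F = step 0F
    from-0F 2F = step 1F ∘ step 0F
    from-0F 3F = step 2F ∘ step 1F ∘ step 0F

  closing-arc₃ : (c : Circuit Γ 2) (i : Fin 3) →
                 Circuit.w c (next Γ (next Γ i)) ⟶ Circuit.w c i
  closing-arc₃ c 0F = Circuit.arcs c 2F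
  closing-arc₃ c 1F = Circuit.arcs c 0F
  closing-arc₃ c 2F = Circuit.arcs c 1F

  closing-arc₄ : (c : Circuit Γ 3) (i : Fin 4) →
                 Circuit.w c (next Γ (next Γ (next Γ i))) ⟶ Circuit.w c i
  closing-arc₄ c 0F = Circuit.arcs c 3F
  closing-arc₄ c 1F = Circuit.arcs c 0F
  closing-arc₄ c 2F = Circuit.arcs c 1F
  closing-arc₄ c 3F = Circuit.arcs c 2F

module Configurations (Γ : Digraph) (3≤n : 3 ≤ Digraph.n Γ) (ls : LocallySemicomplete Γ)
                      (wdr : WeaklyDistanceRegular Γ) (comm : Commutative Γ) where
  open Walks Γ
  open ArcTypes Γ 3≤n
  open IntersectionNumbers Γ wdr
  open Circuits Γ

  private variable
    x y z x₀ x₁ x₂ x₃ : V Γ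

  Adjacent : V Γ → V Γ → Set
  Adjacent x y = x ⟶ y ⊎ y ⟶ x

  out-semicomplete : x ⟶ y → x ⟶ z → y ≢ z → Adjacent y z
  out-semicomplete = proj₁ ls _ _ _

  in-semicomplete : y ⟶ x → z ⟶ x → y ≢ z → Adjacent y z
  in-semicomplete = proj₂ ls _ _ _

  ─[3]→⟶⇒⟶ : x ─[ 3 ]→ y → y ⟶ z → (x ≢ z → Adjacent x z) → x ⟶ z
  ─[3]→⟶⇒⟶ x─y y⟶z adjacent =
    [ id , ⊥-elim ∘ ─[3]→-¬back-path x─y y⟶z ]′ (adjacent λ { refl → ─[3]→-¬back-arc x─y y⟶z })

  ⟶─[3]→⇒⟶ : x ⟶ y → y ─[ 3 ]→ z → (x ≢ z → Adjacent x z) → x ⟶ z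
  ⟶─[3]→⇒⟶ x⟶y y─z adjacent =
    [ id , (λ z⟶x → ⊥-elim (─[3]→-¬back-path y─z z⟶x x⟶y)) ]′
      (adjacent λ { refl → ─[3]→-¬back-arc y─z x⟶y })

  no-triangle-3-2-2 : x ─[ 3 ]→ y → y ─[ 2 ]→ z → x ─[ 2 ]→ z → ⊥
  no-triangle-3-2-2 {x} {y} {z} x─y y─z x─z =
    let s , k , revisit = iterate-revisits step proj₁ (x , x─z)
    in ⟶-irrefl (ascending s k) (sym revisit)
    where
    State : Set
    State = Σ (V Γ) (_─[ 2 ]→ z)
    successor : (s : State) → Witness (proj₁ s) z (1 , 3) (1 , 2)
    successor (a , a─z) = Witness-invariant (trans x─z (sym a─z)) (y , x─y , y─z)
    step : State → State
    step s = let b , _ , b─z = successor s in b , b─z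
    ascending : ∀ s k → proj₁ s ⟶ proj₁ (iterate step s (suc k))
    ascending s zero    = ─[]→⇒⟶ (proj₁ (proj₂ (successor s)))
    ascending s (suc k) = ─[3]→⟶⇒⟶ (proj₁ (proj₂ (successor s))) (ascending (step s) k)
      (in-semicomplete (─[]→⇒⟶ (proj₂ s)) (─[]→⇒⟶ (proj₂ (iterate step s (suc (suc k))))))

  no-triangle-2-3-2 : x ─[ 2 ]→ y → y ─[ 3 ]→ z → x ─[ 2 ]→ z → ⊥
  no-triangle-2-3-2 x─y y─z x─z =
    let w , x─w , w─z = Witness-comm comm (_ , x─y , y─z) in no-triangle-3-2-2 x─w w─z x─z

  p¹³₁₂,₂₁≡0 : p Γ (1 , 3) (1 , 2) (2 , 1) ≡ 0
  p¹³₁₂,₂₁≡0 = p≡0 λ x─y (z , x─z , z~y) → no-triangle-3-2-2 x─y (cong swap z~y) x─z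

  record Ladder : Set where
    field
      a b c d : V Γ
      a⟶b : a ⟶ b
      b⟶a : b ⟶ a
      b⟶c : b ⟶ c
      c⟶b : c ⟶ b
      c⟶d : c ⟶ d
      d⟶c : d ⟶ c
      c⟶a : c ⟶ a
      d⟶b : d ⟶ b
      d─a : d ─[ 3 ]→ a

  Ladder-step : Ladder → Ladder
  Ladder-step L = record
    { a = b ; b = c ; c = d ; d = e
    ; a⟶b = b⟶c ; b⟶a = c⟶b ; b⟶c = c⟶d ; c⟶b = d⟶c
    ; c⟶d = ─[]→⇒⟶ d─e ; d⟶c = ─[1]→⇒⟵ d─e
    ; c⟶a = d⟶b ; d⟶b = e⟶c ; d─a = e─b
    }
    where
    open Ladder L
    next-rung : Witness d b (1 , 1) (1 , 3)
    next-rung = Witness-comm comm (a , d─a , ⟷⇒─[1]→ a⟶b b⟶a)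
    e : V Γ
    e = proj₁ next-rung
    d─e : d ─[ 1 ]→ e
    d─e = proj₁ (proj₂ next-rung)
    e─b : e ─[ 3 ]→ b
    e─b = proj₂ (proj₂ next-rung)
    e⟶c : e ⟶ c
    e⟶c = ─[3]→⟶⇒⟶ e─b b⟶c (out-semicomplete (─[]→⇒⟶ d─e) d⟶c)

  Ladder-descends : ∀ k L → Ladder.a (iterate Ladder-step L (suc k)) ⟶ Ladder.a L
  Ladder-descends 0 L = Ladder.b⟶a L
  Ladder-descends 1 L = Ladder.c⟶a L
  Ladder-descends 2 L = ─[]→⇒⟶ (Ladder.d─a L)
  Ladder-descends (suc (suc (suc k))) L =
    ⟶─[3]→⇒⟶ (Ladder-descends k (iterate Ladder-step L 3)) (Ladder.d─a L)
      (in-semicomplete (Ladder-descends (suc (suc k)) (Ladder-step L)) (Ladder.a⟶b L))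

  ¬Ladder : ¬ Ladder
  ¬Ladder L =
    let L′ , k , revisit = iterate-revisits Ladder-step Ladder.a L
    in ⟶-irrefl (Ladder-descends k L′) revisit

  square-¬⟵ : x₀ ─[ 3 ]→ x₁ → x₁ ⟶ x₂ → x₂ ⟶ x₃ → x₃ ⟶ x₀ → ¬ x₂ ⟶ x₁
  square-¬⟵ {x₀} {x₁} {x₂} {x₃} x₀─x₁ x₁⟶x₂ x₂⟶x₃ x₃⟶x₀ x₂⟶x₁ = ¬Ladder record
    { a = x₁ ; b = x₂ ; c = x₃ ; d = x₀
    ; a⟶b = x₁⟶x₂ ; b⟶a = x₂⟶x₁ ; b⟶c = x₂⟶x₃ ; c⟶b = x₃⟶x₂ ; c⟶d = x₃⟶x₀ ; d⟶c = x₀⟶x₃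
    ; c⟶a = x₃⟶x₁ ; d⟶b = x₀⟶x₂ ; d─a = x₀─x₁
    }
    where
    x₀⟶x₂ : x₀ ⟶ x₂
    x₀⟶x₂ = ─[3]→⟶⇒⟶ x₀─x₁ x₁⟶x₂ (in-semicomplete (─[]→⇒⟶ x₀─x₁) x₂⟶x₁)
    x₃⟶x₁ : x₃ ⟶ x₁
    x₃⟶x₁ = ⟶─[3]→⇒⟶ x₃⟶x₀ x₀─x₁ (out-semicomplete x₂⟶x₃ x₂⟶x₁)
    x₃─x₁ : x₃ ─[ 2 ]→ x₁
    x₃─x₁ = triangle-─[2]→ x₃⟶x₁ x₁⟶x₂ x₂⟶x₃ (λ x₁⟶x₃ → ─[3]→-¬back-path x₀─x₁ x₁⟶x₃ x₃⟶x₀)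
    x₀⟶x₃ : x₀ ⟶ x₃
    x₀⟶x₃ = [ id , (λ x₃─x₀ → ⊥-elim (no-triangle-2-3-2 x₃─x₀ x₀─x₁ x₃─x₁)) ]′
              (triangle-type x₃⟶x₀ x₀⟶x₂ x₂⟶x₃)
    ¬x₂─x₃ : Witness x₀ x₂ (1 , 1) (1 , 3) → ¬ x₂ ─[ 2 ]→ x₃
    ¬x₂─x₃ (w , x₀─w , w─x₂) x₂─x₃ = no-triangle-3-2-2 w─x₂ x₂─x₃
      (triangle-─[2]→ w⟶x₃ x₃⟶x₀ (─[]→⇒⟶ x₀─w) (─[3]→-¬back-path w─x₂ x₂⟶x₃))
      where
      w⟶x₃ : w ⟶ x₃
      w⟶x₃ = ─[3]→⟶⇒⟶ w─x₂ x₂⟶x₃ (out-semicomplete (─[]→⇒⟶ x₀─w) x₀⟶x₃)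
    x₃⟶x₂ : x₃ ⟶ x₂
    x₃⟶x₂ = [ id , ⊥-elim ∘ ¬x₂─x₃ (Witness-comm comm (x₁ , x₀─x₁ , ⟷⇒─[1]→ x₁⟶x₂ x₂⟶x₁)) ]′
              (triangle-type x₂⟶x₃ x₃⟶x₀ x₀⟶x₂)

  square-¬─[2]→ : p Γ (1 , 2) (1 , 3) (1 , 3) ≡ 0 →
                  x₀ ─[ 3 ]→ x₁ → x₁ ⟶ x₂ → x₂ ⟶ x₃ → x₃ ⟶ x₀ → ¬ x₁ ─[ 2 ]→ x₂
  square-¬─[2]→ {x₀} {x₁} {x₂} {x₃} p≡0 x₀─x₁ x₁⟶x₂ x₂⟶x₃ x₃⟶x₀ x₁─x₂ =
    through (∂≡2⇒path (─[]→-back x₁─x₂))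
    where
    x₀⟶x₁ : x₀ ⟶ x₁
    x₀⟶x₁ = ─[]→⇒⟶ x₀─x₁
    ¬x₀⟶x₂ : ¬ x₀ ⟶ x₂
    ¬x₀⟶x₂ x₀⟶x₂ = no-triangle-3-2-2 x₀─x₁ x₁─x₂
      (triangle-─[2]→ x₀⟶x₂ x₂⟶x₃ x₃⟶x₀ (─[3]→-¬back-path x₀─x₁ x₁⟶x₂))
    through : ¬ ∃ λ w → x₂ ⟶ w × w ⟶ x₁
    through (w , x₂⟶w , w⟶x₁) =
      [ ¬x₀⟶w , ¬w⟶x₀ ]′ (in-semicomplete x₀⟶x₁ w⟶x₁ λ { refl → ─[3]→-¬back-path x₀─x₁ x₁⟶x₂ x₂⟶w })
      where
      ¬x₀⟶w : ¬ x₀ ⟶ w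
      ¬x₀⟶w x₀⟶w = ¬x₀⟶x₂ (─[3]→⟶⇒⟶ x₀─x₁ x₁⟶x₂ (in-semicomplete x₀⟶w x₂⟶w))
      w─x₁ : w ⟶ x₀ → w ─[ 2 ]→ x₁
      w─x₁ w⟶x₀ = triangle-─[2]→ w⟶x₁ x₁⟶x₂ x₂⟶w (λ x₁⟶w → ─[3]→-¬back-path x₀─x₁ x₁⟶w w⟶x₀)
      ¬w⟶x₀ : ¬ w ⟶ x₀
      ¬w⟶x₀ w⟶x₀ with square-type w⟶x₀ x₀⟶x₁ x₁⟶x₂ x₂⟶w
      ... | inj₁ x₀⟶w        = ¬x₀⟶w x₀⟶w
      ... | inj₂ (inj₁ w─x₀) = no-triangle-2-3-2 w─x₀ x₀─x₁ (w─x₁ w⟶x₀)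
      ... | inj₂ (inj₂ w─x₀) = Witness⇒p≢0 (w─x₁ w⟶x₀) (x₀ , w─x₀ , x₀─x₁) p≡0

  square-─[3]→ : p Γ (1 , 2) (1 , 3) (1 , 3) ≡ 0 →
                 x₀ ─[ 3 ]→ x₁ → x₁ ⟶ x₂ → x₂ ⟶ x₃ → x₃ ⟶ x₀ → x₁ ─[ 3 ]→ x₂
  square-─[3]→ p≡0 x₀─x₁ x₁⟶x₂ x₂⟶x₃ x₃⟶x₀ with square-type x₁⟶x₂ x₂⟶x₃ x₃⟶x₀ (─[]→⇒⟶ x₀─x₁)
  ... | inj₁ x₂⟶x₁        = ⊥-elim (square-¬⟵ x₀─x₁ x₁⟶x₂ x₂⟶x₃ x₃⟶x₀ x₂⟶x₁)
  ... | inj₂ (inj₁ x₁─x₂) = ⊥-elim (square-¬─[2]→ p≡0 x₀─x₁ x₁⟶x₂ x₂⟶x₃ x₃⟶x₀ x₁─x₂)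
  ... | inj₂ (inj₂ x₁─x₂) = x₁─x₂

  triangle-─[2]→-backward : p Γ (1 , 2) (1 , 3) (1 , 3) ≢ 0 →
                            x ⟶ y → y ─[ 2 ]→ z → z ⟶ x → x ─[ 2 ]→ y
  triangle-─[2]→-backward {x} {y} p≢0 x⟶y y─z z⟶x = triangle-─[2]→ x⟶y (─[]→⇒⟶ y─z) z⟶x ¬y⟶x
    where
    ¬y⟶x : ¬ y ⟶ x
    ¬y⟶x y⟶x =
      let m , y─m , m─z = p≢0⇒Witness y─z p≢0
      in ─[3]→-¬back-path m─z z⟶x (⟶─[3]→⇒⟶ x⟶y y─m (out-semicomplete y⟶x (─[]→⇒⟶ y─m)))

  pure₄ : p Γ (1 , 2) (1 , 3) (1 , 3) ≡ 0 → Pure Γ 4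
  pure₄ p≡0 c (i₀ , typeᵢ₀) = around₄ rotate i₀ typeᵢ₀
    where
    open Circuit c
    rotate : ∀ i → ArcHasType Γ c i 3 → ArcHasType Γ c (next Γ i) 3
    rotate i typeᵢ =
      square-─[3]→ p≡0 typeᵢ (arcs (next Γ i)) (arcs (next Γ (next Γ i))) (closing-arc₄ c i)

  pure₃ : p Γ (1 , 2) (1 , 3) (1 , 3) ≢ 0 → Pure Γ 3
  pure₃ p≢0 c (i₀ , typeᵢ₀) = around₃ rotate i₀ typeᵢ₀
    where
    open Circuit c
    backward : x ⟶ y → y ─[ 2 ]→ z → z ⟶ x → x ─[ 2 ]→ y
    backward = triangle-─[2]→-backward p≢0
    -- on a 3-circuit the next arc is the one preceding the preceding arc
    rotate : ∀ i → ArcHasType Γ c i 2 → ArcHasType Γ c (next Γ i) 2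
    rotate i typeᵢ =
      backward (arcs (next Γ i)) (backward (closing-arc₃ c i) typeᵢ (arcs (next Γ i))) (arcs i)

lemma3p9 : (Γ : Digraph) → LocallySemicomplete Γ → WeaklyDistanceRegular Γ →
           Commutative Γ → InT Γ 4 → Mixed Γ 4 →
           (p Γ (1 , 3) (1 , 2) (2 , 1) ≡ 0) × CExists Γ 4
lemma3p9 Γ ls wdr comm (x , y , x─y) (_ , ¬pure₄) = p¹³₁₂,₂₁≡0 , p¹²₁₃,₁₃≢0 , pure₃ p¹²₁₃,₁₃≢0
  where
  3≤n : 3 ≤ Digraph.n Γ
  3≤n = subst (_≤ Digraph.n Γ) (cong proj₂ x─y) (Walks.∂≤n Γ)
  open Configurations Γ 3≤n ls wdr comm
  p¹²₁₃,₁₃≢0 : p Γ (1 , 2) (1 , 3) (1 , 3) ≢ 0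
  p¹²₁₃,₁₃≢0 = ¬pure₄ ∘ pure₄
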